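{- Let $t$ be an arbor on a set of cardinality $n\ge 2$, let $r$ be the cardinality of the root vertex, and let $t_1,\dots,t_{\mathsf w}$ ($\mathsf w\ge0$) be the sub-trees hanging from the root vertex. Fix an integer $q\ge 2$, let $\mathsf Z_W(q,X)=\prod_{k=1}^{\mathsf w}\mathsf Z_{t_k}(q,X)$ (equal to $1$ if $\mathsf w=0$) and write $\mathsf Z_W(q,X)=\sum_jW_jX^j$. Then for $0\le j\le n$, the coefficient of $X^j$ in $\mathsf Z_t(q,X)$ is $$\sum_{\ell=\max(0,\,j-n+r)}^{j}\binom{r(q-1)+\ell-1}{\ell}W_{j-\ell}.$$
   Context: An arbor on a finite non-empty set $I$ is a rooted tree whose vertices are labeled by pairwise disjoint non-empty subsets of $I$ whose union is $I$; we identify a vertex with its label set. For a vertex $v$, $\mathscr{D}(v)$ is the union of the labels of all vertices whose path to the root passes through $v$ (including $v$). The poset $P_t$ is the set of points $x\in\mathbb{Z}^I$ with $x_i\ge0$ for all $i$ and $\sum_{i\in\mathscr{D}(v)}x_i\le|\mathscr{D}(v)|$ for every vertex $v$, ordered coordinate-wise; $\mathrm{ht}(x)=\sum_ix_i$. For an integer $q\ge2$, $\mathsf Z_t(q,X)=\sum X^{\mathrm{ht}(e_{q-1})}$, the sum over all multichains $e_1\le e_2\le\cdots\le e_{q-1}$ in $P_t$; the same definition applies to each sub-tree $t_k$ (an arbor on the union of its labels). Binomial coefficients with $\ell=0$ equal $1$. -}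

module Defs where

open import Data.Bool using (Bool; true; false; _∧_; if_then_else_)
open import Data.Nat using (ℕ; zero; suc; _+_; _*_; _∸_; _≤ᵇ_; _≡ᵇ_)
open import Data.Fin using (Fin)
open import Data.Fin.Subset using (Subset; _∩_; _∪_; ⊥; ⊤; ∣_∣; Nonempty; ⋃)
open import Data.List using (List; []; _∷_; _++_; map; concatMap; filter; length; upTo; applyUpTo; foldr)
open import Data.Nat.ListAction using (sum)
open import Data.Product using (_×_)
open import Data.List.Relation.Unary.All using (All)
open import Data.List.Relation.Unary.AllPairs using (AllPairs)
open import Data.Vec using (Vec; []; _∷_; zipWith; lookup)
import Data.Vec as Vec
open import Relation.Binary.PropositionalEquality using (_≡_)
open import Relation.Nullary.Decidable using (T?)

-- The ground set I of cardinality n is identified with Fin n.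
data Arbor (n : ℕ) : Set where
  node : Subset n → List (Arbor n) → Arbor n

rootLabel : ∀ {n} → Arbor n → Subset n
rootLabel (node L _) = L

children : ∀ {n} → Arbor n → List (Arbor n)
children (node _ cs) = cs

mutual
  labels : ∀ {n} → Arbor n → List (Subset n)
  labels (node L cs) = L ∷ labelsF cs

  labelsF : ∀ {n} → List (Arbor n) → List (Subset n)
  labelsF [] = []
  labelsF (c ∷ cs) = labels c ++ labelsF cs

mutual
  vertices : ∀ {n} → Arbor n → List (Arbor n)
  vertices (node L cs) = node L cs ∷ verticesF cs

  verticesF : ∀ {n} → List (Arbor n) → List (Arbor n)
  verticesF [] = []
  verticesF (c ∷ cs) = vertices c ++ verticesF cs

𝒟 : ∀ {n} → Arbor n → Subset n
𝒟 t = ⋃ (labels t)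

Disjoint : ∀ {n} → Subset n → Subset n → Set
Disjoint p q = p ∩ q ≡ ⊥

IsArborOn : ∀ {n} → Arbor n → Subset n → Set
IsArborOn t I = All Nonempty (labels t) × AllPairs Disjoint (labels t) × (𝒟 t ≡ I)

-- The poset P_t.  A point of ℤ^{𝒟(t)} with nonnegative coordinates is encoded
-- as a vector in ℕ^n vanishing outside 𝒟(t).

sumOver : ∀ {n} → Subset n → Vec ℕ n → ℕ
sumOver S x = Vec.sum (zipWith (λ b v → if b then v else 0) S x)

ht : ∀ {n} → Vec ℕ n → ℕ
ht = Vec.sum

supportedIn : ∀ {n} → Subset n → Vec ℕ n → Bool
supportedIn [] [] = true
supportedIn (b ∷ S) (v ∷ x) = (if b then true else (v ≡ᵇ 0)) ∧ supportedIn S x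

allB : ∀ {A : Set} → (A → Bool) → List A → Bool
allB p [] = true
allB p (a ∷ as) = p a ∧ allB p as

inP : ∀ {n} → Arbor n → Vec ℕ n → Bool
inP t x = supportedIn (𝒟 t) x ∧ allB (λ v → sumOver (𝒟 v) x ≤ᵇ ∣ 𝒟 v ∣) (vertices t)

box : (n N : ℕ) → List (Vec ℕ n)
box zero N = [] ∷ []
box (suc n) N = concatMap (λ a → map (a ∷_) (box n N)) (upTo (suc N))

-- the elements of P_t (every coordinate of a point of P_t is ≤ |𝒟(t)| ≤ n)
points : ∀ {n} → Arbor n → List (Vec ℕ n)
points {n} t = filter (λ x → T? (inP t x)) (box n n)

leqV : ∀ {n} → Vec ℕ n → Vec ℕ n → Bool
leqV [] [] = true
leqV (a ∷ x) (b ∷ y) = (a ≤ᵇ b) ∧ leqV x y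

seqs : ∀ {A : Set} → ℕ → List A → List (List A)
seqs zero xs = [] ∷ []
seqs (suc m) xs = concatMap (λ a → map (a ∷_) (seqs m xs)) xs

isMultichain : ∀ {n} → List (Vec ℕ n) → Bool
isMultichain [] = true
isMultichain (e ∷ []) = true
isMultichain (e ∷ f ∷ es) = leqV e f ∧ isMultichain (f ∷ es)

-- height of the last element e_m (0 for the empty list, never used since q ≥ 2)
lastHt : ∀ {n} → List (Vec ℕ n) → ℕ
lastHt [] = 0
lastHt (e ∷ []) = ht e
lastHt (e ∷ f ∷ es) = lastHt (f ∷ es)

Zcoef : ∀ {n} → Arbor n → ℕ → ℕ → ℕ
Zcoef t q j = length (filter (λ c → T? (isMultichain c ∧ (lastHt c ≡ᵇ j))) (seqs (q ∸ 1) (points t)))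

-- Polynomials with ℕ coefficients as coefficient functions.

-- Σ_{i=a}^{b} f i   (empty if b < a)
sumFromTo : ℕ → ℕ → (ℕ → ℕ) → ℕ
sumFromTo a b f = sum (map f (applyUpTo (a +_) (suc b ∸ a)))

_⊛_ : (ℕ → ℕ) → (ℕ → ℕ) → (ℕ → ℕ)
(f ⊛ g) j = sumFromTo 0 j (λ i → f i * g (j ∸ i))

onePoly : ℕ → ℕ
onePoly zero = 1
onePoly (suc _) = 0

Wcoef : ∀ {n} → List (Arbor n) → ℕ → ℕ → ℕ
Wcoef ts q = foldr (λ s acc → Zcoef s q ⊛ acc) onePoly ts

-- Since P_t is a down-set of ℕⁿ, the multichains e₁ ≤ ⋯ ≤ e_{q-1} = v in P_t are those of ℕⁿ,
-- and there are ∏ᵢ C(q-2+vᵢ, vᵢ) of them; so Z_t(q,X) sums these products over v ∈ P_t, graded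
-- by height.  The constraints defining P_t split along the root label R and the pairwise disjoint
-- vertex sets of the sub-trees, except for the root constraint ht v ≤ n, which is vacuous in the
-- heights j ≤ n considered.  The generating function therefore factors as (1 - X)^{-r(q-1)}, from
-- the unconstrained coordinates in R, times Z_W(q,X).  Finally W_k = 0 for k > n - r, which
-- accounts for the lower summation limit.

module Submission where

open import Defs
open import Data.Bool using (Bool; true; false; _∧_; T)
open import Data.Bool.Properties using (∧-assoc; T-∧; T-≡)
open import Data.Empty using (⊥-elim)
open import Data.Fin.Subset using (Subset; _∩_; _∪_; ⋃; ⊤; ∣_∣) renaming (⊥ to ∅)
open import Data.Fin.Subset.Properties
  using (∩-assoc; ∩-abs-∪; ∪-comm; ∩-idem; ∩-distribˡ-∪; ∩-distribʳ-∪; ∪-identityˡ; ∪-assoc; ∩-zeroʳ; ∩-zeroˡ; ∣⊤∣≡n; ∣p∣≤n)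
open import Data.List using (List; []; _∷_; _++_; map; concatMap; filter; length; applyUpTo; upTo)
open import Data.List.Relation.Unary.All using (All; []; _∷_)
import Data.List.Relation.Unary.All.Properties as All
open import Data.List.Relation.Unary.AllPairs using (AllPairs; []; _∷_)
open import Data.Nat using (ℕ; zero; suc; _+_; _*_; _∸_; _≤_; _<_; _≤ᵇ_; _<ᵇ_; _≡ᵇ_; z≤n; s≤s)
open import Data.Nat.Combinatorics using (_C_; k>n⇒nCk≡0; nCn≡1; nCk+nC[k+1]≡[n+1]C[k+1])
open import Data.Nat.ListAction using (sum)
open import Data.Nat.Properties
open import Algebra.Properties.CommutativeSemigroup +-commutativeSemigroup
  using () renaming (interchange to +-interchange)
open import Data.Nat.Tactic.RingSolver using (solve-∀)
open import Data.Product using (_×_; _,_; proj₂)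
open import Data.Sum using (inj₁; inj₂)
open import Data.Vec using (Vec; []; _∷_)
open import Data.Vec.Properties using (∷-injectiveʳ)
import Data.Vec.Relation.Unary.All as Vec
open import Function.Bundles using (module Equivalence)
open import Relation.Nullary using (yes; no)
open import Relation.Nullary.Decidable using (T?)
open import Relation.Binary.PropositionalEquality
  using (_≡_; refl; sym; trans; cong; cong₂; subst; module ≡-Reasoning)

open Equivalence using (to; from)

[_] : Bool → ℕ
[ true ] = 1
[ false ] = 0

[∧] : ∀ a b → [ a ∧ b ] ≡ [ a ] * [ b ]
[∧] true b = sym (+-identityʳ [ b ])
[∧] false b = refl

∑ : ℕ → (ℕ → ℕ) → ℕ
∑ zero f = 0
∑ (suc k) f = f 0 + ∑ k (λ i → f (suc i))

∑-cong< : ∀ k {f g : ℕ → ℕ} → (∀ i → i < k → f i ≡ g i) → ∑ k f ≡ ∑ k g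
∑-cong< zero eq = refl
∑-cong< (suc k) eq = cong₂ _+_ (eq 0 (s≤s z≤n)) (∑-cong< k (λ i i<k → eq (suc i) (s≤s i<k)))

∑-cong : ∀ k {f g : ℕ → ℕ} → (∀ i → f i ≡ g i) → ∑ k f ≡ ∑ k g
∑-cong k eq = ∑-cong< k (λ i _ → eq i)

∑-zero : ∀ k {f : ℕ → ℕ} → (∀ i → i < k → f i ≡ 0) → ∑ k f ≡ 0
∑-zero zero eq = refl
∑-zero (suc k) eq = cong₂ _+_ (eq 0 (s≤s z≤n)) (∑-zero k (λ i i<k → eq (suc i) (s≤s i<k)))

∑-distrib-+ : ∀ k (f g : ℕ → ℕ) → ∑ k (λ i → f i + g i) ≡ ∑ k f + ∑ k g
∑-distrib-+ zero f g = refl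
∑-distrib-+ (suc k) f g =
  trans (cong (f 0 + g 0 +_) (∑-distrib-+ k _ _)) (+-interchange (f 0) (g 0) _ _)

∑-*ˡ : ∀ k c (f : ℕ → ℕ) → ∑ k (λ i → c * f i) ≡ c * ∑ k f
∑-*ˡ zero c f = sym (*-zeroʳ c)
∑-*ˡ (suc k) c f = trans (cong (c * f 0 +_) (∑-*ˡ k c _)) (sym (*-distribˡ-+ c (f 0) _))

∑-*ʳ : ∀ k c (f : ℕ → ℕ) → ∑ k (λ i → f i * c) ≡ ∑ k f * c
∑-*ʳ k c f = trans (∑-cong k (λ i → *-comm (f i) c)) (trans (∑-*ˡ k c f) (*-comm c _))

∑-snoc : ∀ k (f : ℕ → ℕ) → ∑ (suc k) f ≡ ∑ k f + f k
∑-snoc zero f = +-identityʳ (f 0)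
∑-snoc (suc k) f = trans (cong (f 0 +_) (∑-snoc k (λ i → f (suc i)))) (sym (+-assoc (f 0) _ _))

∑-split : ∀ a k (f : ℕ → ℕ) → ∑ (a + k) f ≡ ∑ a f + ∑ k (λ i → f (a + i))
∑-split zero k f = refl
∑-split (suc a) k f = trans (cong (f 0 +_) (∑-split a k (λ i → f (suc i)))) (sym (+-assoc (f 0) _ _))

∑-reverse : ∀ k (f : ℕ → ℕ) → ∑ k f ≡ ∑ k (λ i → f (k ∸ suc i))
∑-reverse zero f = refl
∑-reverse (suc k) f = begin
  ∑ (suc k) f                      ≡⟨ ∑-snoc k f ⟩
  ∑ k f + f k                      ≡⟨ +-comm (∑ k f) (f k) ⟩
  f k + ∑ k f                      ≡⟨ cong (f k +_) (∑-reverse k f) ⟩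
  f k + ∑ k (λ i → f (k ∸ suc i))  ∎
  where open ≡-Reasoning

sumBy : ∀ {A : Set} → (A → ℕ) → List A → ℕ
sumBy f xs = sum (map f xs)

sumBy-applyUpTo : ∀ {A : Set} k (f : A → ℕ) (g : ℕ → A) → sumBy f (applyUpTo g k) ≡ ∑ k (λ i → f (g i))
sumBy-applyUpTo zero f g = refl
sumBy-applyUpTo (suc k) f g = cong (f (g 0) +_) (sumBy-applyUpTo k f (λ i → g (suc i)))

sumFromTo≡∑ : ∀ a b f → sumFromTo a b f ≡ ∑ (suc b ∸ a) (λ i → f (a + i))
sumFromTo≡∑ a b f = sumBy-applyUpTo (suc b ∸ a) f (a +_)

sumBy-cong : ∀ {A : Set} (xs : List A) {f g : A → ℕ} → (∀ x → f x ≡ g x) → sumBy f xs ≡ sumBy g xs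
sumBy-cong [] eq = refl
sumBy-cong (x ∷ xs) eq = cong₂ _+_ (eq x) (sumBy-cong xs eq)

sumBy-zero : ∀ {A : Set} (xs : List A) → sumBy (λ _ → 0) xs ≡ 0
sumBy-zero [] = refl
sumBy-zero (x ∷ xs) = sumBy-zero xs

sumBy-distrib-+ : ∀ {A : Set} (xs : List A) (f g : A → ℕ) → sumBy (λ x → f x + g x) xs ≡ sumBy f xs + sumBy g xs
sumBy-distrib-+ [] f g = refl
sumBy-distrib-+ (x ∷ xs) f g =
  trans (cong (f x + g x +_) (sumBy-distrib-+ xs f g)) (+-interchange (f x) (g x) _ _)

sumBy-++ : ∀ {A : Set} (xs ys : List A) (f : A → ℕ) → sumBy f (xs ++ ys) ≡ sumBy f xs + sumBy f ys
sumBy-++ [] ys f = refl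
sumBy-++ (x ∷ xs) ys f = trans (cong (f x +_) (sumBy-++ xs ys f)) (sym (+-assoc (f x) _ _))

sumBy-map : ∀ {A B : Set} (xs : List A) (g : A → B) (f : B → ℕ) → sumBy f (map g xs) ≡ sumBy (λ x → f (g x)) xs
sumBy-map [] g f = refl
sumBy-map (x ∷ xs) g f = cong (f (g x) +_) (sumBy-map xs g f)

sumBy-concatMap : ∀ {A B : Set} (xs : List A) (g : A → List B) (f : B → ℕ) →
  sumBy f (concatMap g xs) ≡ sumBy (λ x → sumBy f (g x)) xs
sumBy-concatMap [] g f = refl
sumBy-concatMap (x ∷ xs) g f =
  trans (sumBy-++ (g x) (concatMap g xs) f) (cong (sumBy f (g x) +_) (sumBy-concatMap xs g f))

sumBy-swap : ∀ {A B : Set} (xs : List A) (ys : List B) (F : A → B → ℕ) →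
  sumBy (λ x → sumBy (F x) ys) xs ≡ sumBy (λ y → sumBy (λ x → F x y) xs) ys
sumBy-swap [] ys F = sym (sumBy-zero ys)
sumBy-swap (x ∷ xs) ys F =
  trans (cong (sumBy (F x) ys +_) (sumBy-swap xs ys F)) (sym (sumBy-distrib-+ ys (F x) _))

sumBy-*ˡ : ∀ {A : Set} (xs : List A) c (f : A → ℕ) → sumBy (λ x → c * f x) xs ≡ c * sumBy f xs
sumBy-*ˡ [] c f = sym (*-zeroʳ c)
sumBy-*ˡ (x ∷ xs) c f = trans (cong (c * f x +_) (sumBy-*ˡ xs c f)) (sym (*-distribˡ-+ c (f x) _))

sumBy-*ʳ : ∀ {A : Set} (xs : List A) c (f : A → ℕ) → sumBy (λ x → f x * c) xs ≡ sumBy f xs * c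
sumBy-*ʳ xs c f = trans (sumBy-cong xs (λ x → *-comm (f x) c)) (trans (sumBy-*ˡ xs c f) (*-comm c _))

length-filter : ∀ {A : Set} (p : A → Bool) (xs : List A) →
  length (filter (λ x → T? (p x)) xs) ≡ sumBy (λ x → [ p x ]) xs
length-filter p [] = refl
length-filter p (x ∷ xs) with p x
... | true = cong suc (length-filter p xs)
... | false = length-filter p xs

sumBy-filter : ∀ {A : Set} (p : A → Bool) (f : A → ℕ) (xs : List A) →
  sumBy f (filter (λ x → T? (p x)) xs) ≡ sumBy (λ x → [ p x ] * f x) xs
sumBy-filter p f [] = refl
sumBy-filter p f (x ∷ xs) with p x
... | true = cong₂ _+_ (sym (+-identityʳ (f x))) (sumBy-filter p f xs)
... | false = sumBy-filter p f xs

-- Convolution of coefficient sequences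

diagSum : (ℕ → ℕ → ℕ) → ℕ → ℕ
diagSum F k = ∑ (suc k) (λ a → F a (k ∸ a))

conv : (ℕ → ℕ) → (ℕ → ℕ) → ℕ → ℕ
conv f g = diagSum (λ a b → f a * g b)

⊛≗conv : ∀ f g j → (f ⊛ g) j ≡ conv f g j
⊛≗conv f g j = sumBy-applyUpTo (suc j) (λ i → f i * g (j ∸ i)) (0 +_)

conv-congˡ : ∀ {f f′ : ℕ → ℕ} g j → (∀ i → i ≤ j → f i ≡ f′ i) → conv f g j ≡ conv f′ g j
conv-congˡ g j eq = ∑-cong< (suc j) (λ i i≤j → cong (_* g (j ∸ i)) (eq i (≤-pred i≤j)))

conv-congʳ : ∀ f {g g′ : ℕ → ℕ} j → (∀ i → i ≤ j → g i ≡ g′ i) → conv f g j ≡ conv f g′ j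
conv-congʳ f j eq = ∑-cong< (suc j) (λ i _ → cong (f i *_) (eq (j ∸ i) (m∸n≤m j i)))

∑-triangle : ∀ j F → ∑ (suc j) (λ a → ∑ (suc (j ∸ a)) (F a)) ≡ ∑ (suc j) (diagSum F)
∑-triangle zero F = refl
∑-triangle (suc j) F =
  trans (cong (∑ (suc (suc j)) (F 0) +_) (∑-triangle j (λ a → F (suc a))))
        (sym (∑-distrib-+ (suc (suc j)) (F 0) (λ s → ∑ s (λ a → F (suc a) (s ∸ suc a)))))

diagSum-flip : ∀ F s → diagSum F s ≡ diagSum (λ b a → F a b) s
diagSum-flip F s = trans (∑-reverse (suc s) (λ a → F a (s ∸ a)))
  (∑-cong< (suc s) (λ i i≤s → cong (F (s ∸ i)) (m∸[m∸n]≡n (≤-pred i≤s))))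

∑-triangle-swap : ∀ j F →
  ∑ (suc j) (λ a → ∑ (suc (j ∸ a)) (F a)) ≡ ∑ (suc j) (λ b → ∑ (suc (j ∸ b)) (λ a → F a b))
∑-triangle-swap j F = begin
  ∑ (suc j) (λ a → ∑ (suc (j ∸ a)) (F a))              ≡⟨ ∑-triangle j F ⟩
  ∑ (suc j) (diagSum F)                                ≡⟨ ∑-cong (suc j) (diagSum-flip F) ⟩
  ∑ (suc j) (diagSum (λ b a → F a b))                  ≡⟨ ∑-triangle j (λ b a → F a b) ⟨
  ∑ (suc j) (λ b → ∑ (suc (j ∸ b)) (λ a → F a b))      ∎
  where open ≡-Reasoning

conv-comm : ∀ f g j → conv f g j ≡ conv g f j
conv-comm f g j = trans (diagSum-flip (λ a b → f a * g b) j) (∑-cong (suc j) (λ i → *-comm (f (j ∸ i)) (g i)))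

diagSum-conv-distribʳ : ∀ j (P : ℕ → ℕ → ℕ) Q →
  diagSum (λ a → conv (P a) Q) j ≡ conv (diagSum P) Q j
diagSum-conv-distribʳ j P Q = begin
  ∑ (suc j) (λ a → ∑ (suc (j ∸ a)) (λ b → P a b * Q (j ∸ a ∸ b)))
    ≡⟨ ∑-triangle j (λ a b → P a b * Q (j ∸ a ∸ b)) ⟩
  ∑ (suc j) (λ s → ∑ (suc s) (λ a → P a (s ∸ a) * Q (j ∸ a ∸ (s ∸ a))))
    ≡⟨ ∑-cong (suc j) (λ s → ∑-cong< (suc s) (λ a a≤s → cong (λ x → P a (s ∸ a) * Q x) (j∸a∸[s∸a] (≤-pred a≤s)))) ⟩
  ∑ (suc j) (λ s → ∑ (suc s) (λ a → P a (s ∸ a) * Q (j ∸ s)))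
    ≡⟨ ∑-cong (suc j) (λ s → ∑-*ʳ (suc s) (Q (j ∸ s)) (λ a → P a (s ∸ a))) ⟩
  conv (diagSum P) Q j
    ∎
  where
  open ≡-Reasoning
  j∸a∸[s∸a] : ∀ {a s} → a ≤ s → j ∸ a ∸ (s ∸ a) ≡ j ∸ s
  j∸a∸[s∸a] {a} {s} a≤s = trans (∸-+-assoc j a (s ∸ a)) (cong (j ∸_) (m+[n∸m]≡n a≤s))

diagSum-conv-distribˡ : ∀ j P (Q : ℕ → ℕ → ℕ) →
  diagSum (λ a → conv P (Q a)) j ≡ conv P (diagSum Q) j
diagSum-conv-distribˡ j P Q = begin
  ∑ (suc j) (λ a → ∑ (suc (j ∸ a)) (λ b → P b * Q a (j ∸ a ∸ b)))
    ≡⟨ ∑-triangle-swap j (λ a b → P b * Q a (j ∸ a ∸ b)) ⟩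
  ∑ (suc j) (λ b → ∑ (suc (j ∸ b)) (λ a → P b * Q a (j ∸ a ∸ b)))
    ≡⟨ ∑-cong (suc j) (λ b → ∑-cong (suc (j ∸ b)) (λ a → cong (λ x → P b * Q a x) (∸-comm j a b))) ⟩
  ∑ (suc j) (λ b → ∑ (suc (j ∸ b)) (λ a → P b * Q a (j ∸ b ∸ a)))
    ≡⟨ ∑-cong (suc j) (λ b → ∑-*ˡ (suc (j ∸ b)) (P b) (λ a → Q a (j ∸ b ∸ a))) ⟩
  conv P (diagSum Q) j
    ∎
  where
  open ≡-Reasoning
  ∸-comm : ∀ j a b → j ∸ a ∸ b ≡ j ∸ b ∸ a
  ∸-comm j a b = trans (∸-+-assoc j a b) (trans (cong (j ∸_) (+-comm a b)) (sym (∸-+-assoc j b a)))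

conv-identityˡ : ∀ g j → conv onePoly g j ≡ g j
conv-identityˡ g j =
  trans (cong ((g j + 0) +_) (∑-zero j (λ _ _ → refl))) (trans (+-identityʳ _) (+-identityʳ (g j)))

partialSums : (ℕ → ℕ) → ℕ → ℕ
partialSums f k = ∑ (suc k) f

conv-partialSums : ∀ f g j → conv (partialSums f) g j ≡ conv f (partialSums g) j
conv-partialSums f g j = begin
  conv (partialSums f) g j
    ≡⟨ conv-comm (partialSums f) g j ⟩
  conv g (partialSums f) j
    ≡⟨ ∑-cong (suc j) (λ a → trans (*-comm (g a) (partialSums f (j ∸ a))) (sym (∑-*ʳ (suc (j ∸ a)) (g a) f))) ⟩
  diagSum (λ a → conv f (λ _ → g a)) j
    ≡⟨ diagSum-conv-distribˡ j f (λ a _ → g a) ⟩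
  conv f (partialSums g) j
    ∎
  where open ≡-Reasoning

-- The coefficient of Xˡ in (1 - X)⁻ᵏ.
multichoose : ℕ → ℕ → ℕ
multichoose k ℓ = (k + ℓ ∸ 1) C ℓ

multichoose-zero : ∀ ℓ → multichoose 0 ℓ ≡ onePoly ℓ
multichoose-zero zero = refl
multichoose-zero (suc ℓ) = k>n⇒nCk≡0 (n<1+n ℓ)

multichoose-one : ∀ ℓ → multichoose 1 ℓ ≡ 1
multichoose-one = nCn≡1

partialSums-multichoose : ∀ k ℓ → partialSums (multichoose k) ℓ ≡ multichoose (suc k) ℓ
partialSums-multichoose k zero = refl
partialSums-multichoose k (suc ℓ) = begin
  partialSums (multichoose k) (suc ℓ)
    ≡⟨ ∑-snoc (suc ℓ) (multichoose k) ⟩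
  partialSums (multichoose k) ℓ + multichoose k (suc ℓ)
    ≡⟨ cong₂ _+_ (partialSums-multichoose k ℓ) (cong (λ x → (x ∸ 1) C suc ℓ) (+-suc k ℓ)) ⟩
  (k + ℓ) C ℓ + (k + ℓ) C suc ℓ
    ≡⟨ nCk+nC[k+1]≡[n+1]C[k+1] (k + ℓ) ℓ ⟩
  suc (k + ℓ) C suc ℓ
    ≡⟨ cong (λ x → (x ∸ 1) C suc ℓ) (+-suc (suc k) ℓ) ⟨
  multichoose (suc k) (suc ℓ)
    ∎
  where open ≡-Reasoning

conv-multichoose : ∀ a b ℓ → conv (multichoose a) (multichoose b) ℓ ≡ multichoose (a + b) ℓ
conv-multichoose zero b ℓ =
  trans (conv-congˡ (multichoose b) ℓ (λ i _ → multichoose-zero i)) (conv-identityˡ (multichoose b) ℓ)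
conv-multichoose (suc a) b ℓ = begin
  conv (multichoose (suc a)) (multichoose b) ℓ
    ≡⟨ conv-congˡ (multichoose b) ℓ (λ i _ → partialSums-multichoose a i) ⟨
  conv (partialSums (multichoose a)) (multichoose b) ℓ
    ≡⟨ conv-partialSums (multichoose a) (multichoose b) ℓ ⟩
  conv (multichoose a) (partialSums (multichoose b)) ℓ
    ≡⟨ conv-congʳ (multichoose a) ℓ (λ i _ → partialSums-multichoose b i) ⟩
  conv (multichoose a) (multichoose (suc b)) ℓ
    ≡⟨ conv-multichoose a (suc b) ℓ ⟩
  multichoose (a + suc b) ℓ
    ≡⟨ cong (λ x → multichoose x ℓ) (+-suc a b) ⟩
  multichoose (suc a + b) ℓ
    ∎
  where open ≡-Reasoning

-- Sums over the lattice points of a given height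

∏ : ∀ {n} → (ℕ → ℕ) → Vec ℕ n → ℕ
∏ w [] = 1
∏ w (a ∷ v) = w a * ∏ w v

∏-cong : ∀ {n} {w w′ : ℕ → ℕ} → (∀ a → w a ≡ w′ a) → (v : Vec ℕ n) → ∏ w v ≡ ∏ w′ v
∏-cong eq [] = refl
∏-cong eq (a ∷ v) = cong₂ _*_ (eq a) (∏-cong eq v)

∏-one : ∀ {n} (v : Vec ℕ n) → ∏ (λ _ → 1) v ≡ 1
∏-one [] = refl
∏-one (a ∷ v) = trans (+-identityʳ _) (∏-one v)

restrict : ∀ {n} → Subset n → Vec ℕ n → Vec ℕ n
restrict [] [] = []
restrict (true ∷ S) (a ∷ v) = a ∷ restrict S v
restrict (false ∷ S) (a ∷ v) = 0 ∷ restrict S v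

-- levelSum S f j is the sum of f v over the v ∈ ℕⁿ supported in S with ht v = j.
levelSum : ∀ {n} → Subset n → (Vec ℕ n → ℕ) → ℕ → ℕ
levelSum [] f j = f [] * onePoly j
levelSum (false ∷ S) f j = levelSum S (λ v → f (0 ∷ v)) j
levelSum (true ∷ S) f j = diagSum (λ a → levelSum S (λ v → f (a ∷ v))) j

levelSum-cong : ∀ {n} (S : Subset n) (f g : Vec ℕ n → ℕ) j →
  (∀ v → T (supportedIn S v) → ht v ≡ j → f v ≡ g v) → levelSum S f j ≡ levelSum S g j
levelSum-cong [] f g zero eq = cong (_* 1) (eq [] _ refl)
levelSum-cong [] f g (suc j) eq = trans (*-zeroʳ (f [])) (sym (*-zeroʳ (g [])))
levelSum-cong (false ∷ S) f g j eq = levelSum-cong S _ _ j (λ v s h → eq (0 ∷ v) s h)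
levelSum-cong (true ∷ S) f g j eq = ∑-cong< (suc j) (λ a a≤j → levelSum-cong S _ _ (j ∸ a)
  (λ v s h → eq (a ∷ v) s (trans (cong (a +_) h) (m+[n∸m]≡n (≤-pred a≤j)))))

levelSum-zero : ∀ {n} (S : Subset n) j → levelSum S (λ _ → 0) j ≡ 0
levelSum-zero [] j = refl
levelSum-zero (false ∷ S) j = levelSum-zero S j
levelSum-zero (true ∷ S) j = ∑-zero (suc j) (λ a _ → levelSum-zero S (j ∸ a))

levelSum-vanish : ∀ {n} (S : Subset n) f j →
  (∀ v → T (supportedIn S v) → ht v ≡ j → f v ≡ 0) → levelSum S f j ≡ 0
levelSum-vanish S f j eq = trans (levelSum-cong S f (λ _ → 0) j eq) (levelSum-zero S j)

levelSum-*ˡ : ∀ {n} (S : Subset n) c f j → levelSum S (λ v → c * f v) j ≡ c * levelSum S f j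
levelSum-*ˡ [] c f j = *-assoc c (f []) (onePoly j)
levelSum-*ˡ (false ∷ S) c f j = levelSum-*ˡ S c (λ v → f (0 ∷ v)) j
levelSum-*ˡ (true ∷ S) c f j =
  trans (∑-cong (suc j) (λ a → levelSum-*ˡ S c (λ v → f (a ∷ v)) (j ∸ a)))
        (∑-*ˡ (suc j) c (λ a → levelSum S (λ v → f (a ∷ v)) (j ∸ a)))

levelSum-∅ : ∀ n j → levelSum (∅ {n}) (λ _ → 1) j ≡ onePoly j
levelSum-∅ zero j = +-identityʳ _
levelSum-∅ (suc n) j = levelSum-∅ n j

levelSum-∪ : ∀ {n} (A B : Subset n) (f g : Vec ℕ n → ℕ) → Disjoint A B → ∀ j →
  levelSum (A ∪ B) (λ v → f (restrict A v) * g (restrict B v)) j ≡ conv (levelSum A f) (levelSum B g) j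
levelSum-∪ [] [] f g _ j = sym (conv-scaled-onePoly (f []) (g []) j)
  where
  conv-scaled-onePoly : ∀ c d j → conv (λ i → c * onePoly i) (λ i → d * onePoly i) j ≡ c * d * onePoly j
  conv-scaled-onePoly c d j =
    trans (cong (c * 1 * (d * onePoly j) +_) (∑-zero j (λ i _ → cong (_* (d * onePoly (j ∸ suc i))) (*-zeroʳ c))))
          (rearrange c d (onePoly j))
    where
    rearrange : ∀ c d x → c * 1 * (d * x) + 0 ≡ c * d * x
    rearrange = solve-∀
levelSum-∪ (false ∷ A) (false ∷ B) f g A#B j =
  levelSum-∪ A B (λ v → f (0 ∷ v)) (λ v → g (0 ∷ v)) (∷-injectiveʳ A#B) j
levelSum-∪ (true ∷ A) (false ∷ B) f g A#B j =
  trans (∑-cong (suc j) (λ a → levelSum-∪ A B (λ v → f (a ∷ v)) (λ v → g (0 ∷ v)) (∷-injectiveʳ A#B) (j ∸ a)))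
        (diagSum-conv-distribʳ j (λ a → levelSum A (λ v → f (a ∷ v))) (levelSum B (λ v → g (0 ∷ v))))
levelSum-∪ (false ∷ A) (true ∷ B) f g A#B j =
  trans (∑-cong (suc j) (λ a → levelSum-∪ A B (λ v → f (0 ∷ v)) (λ v → g (a ∷ v)) (∷-injectiveʳ A#B) (j ∸ a)))
        (diagSum-conv-distribˡ j (levelSum A (λ v → f (0 ∷ v))) (λ a → levelSum B (λ v → g (a ∷ v))))
levelSum-∪ (true ∷ A) (true ∷ B) f g () j

levelSum-∏-multichoose : ∀ {n} (R : Subset n) k j → levelSum R (∏ (multichoose k)) j ≡ multichoose (∣ R ∣ * k) j
levelSum-∏-multichoose [] k j = trans (+-identityʳ (onePoly j)) (sym (multichoose-zero j))
levelSum-∏-multichoose (false ∷ R) k j =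
  trans (levelSum-*ˡ R 1 (∏ (multichoose k)) j) (trans (*-identityˡ _) (levelSum-∏-multichoose R k j))
levelSum-∏-multichoose (true ∷ R) k j =
  trans (∑-cong (suc j) (λ a → trans (levelSum-*ˡ R (multichoose k a) (∏ (multichoose k)) (j ∸ a))
                                     (cong (multichoose k a *_) (levelSum-∏-multichoose R k (j ∸ a)))))
        (conv-multichoose k (∣ R ∣ * k) j)

sumBy-box-∷ : ∀ n N (F : Vec ℕ (suc n) → ℕ) →
  sumBy F (box (suc n) N) ≡ ∑ (suc N) (λ a → sumBy (λ v → F (a ∷ v)) (box n N))
sumBy-box-∷ n N F = begin
  sumBy F (concatMap (λ a → map (a ∷_) (box n N)) (upTo (suc N)))
    ≡⟨ sumBy-concatMap (upTo (suc N)) (λ a → map (a ∷_) (box n N)) F ⟩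
  sumBy (λ a → sumBy F (map (a ∷_) (box n N))) (upTo (suc N))
    ≡⟨ sumBy-cong (upTo (suc N)) (λ a → sumBy-map (box n N) (a ∷_) F) ⟩
  sumBy (λ a → sumBy (λ v → F (a ∷ v)) (box n N)) (upTo (suc N))
    ≡⟨ sumBy-applyUpTo (suc N) (λ a → sumBy (λ v → F (a ∷ v)) (box n N)) (λ i → i) ⟩
  ∑ (suc N) (λ a → sumBy (λ v → F (a ∷ v)) (box n N))
    ∎
  where open ≡-Reasoning

sumBy-box-cong : ∀ n N (F G : Vec ℕ n → ℕ) → (∀ v → Vec.All (_≤ N) v → F v ≡ G v) →
  sumBy F (box n N) ≡ sumBy G (box n N)
sumBy-box-cong zero N F G eq = cong (_+ 0) (eq [] Vec.[])
sumBy-box-cong (suc n) N F G eq = begin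
  sumBy F (box (suc n) N)
    ≡⟨ sumBy-box-∷ n N F ⟩
  ∑ (suc N) (λ a → sumBy (λ v → F (a ∷ v)) (box n N))
    ≡⟨ ∑-cong< (suc N) (λ a a≤N → sumBy-box-cong n N _ _ (λ v v≤N → eq (a ∷ v) (≤-pred a≤N Vec.∷ v≤N))) ⟩
  ∑ (suc N) (λ a → sumBy (λ v → G (a ∷ v)) (box n N))
    ≡⟨ sumBy-box-∷ n N G ⟨
  sumBy G (box (suc n) N)
    ∎
  where open ≡-Reasoning

≤ᵇ≡<ᵇ-suc : ∀ a j → (a ≤ᵇ j) ≡ (a <ᵇ suc j)
≤ᵇ≡<ᵇ-suc zero j = refl
≤ᵇ≡<ᵇ-suc (suc a) j = refl

∑-≤ᵇ : ∀ N j (X : ℕ → ℕ) → j ≤ N → ∑ (suc N) (λ a → [ a ≤ᵇ j ] * X a) ≡ ∑ (suc j) X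
∑-≤ᵇ N zero X _ = cong₂ _+_ (+-identityʳ (X 0)) (∑-zero N (λ _ _ → refl))
∑-≤ᵇ (suc N) (suc j) X (s≤s j≤N) = cong₂ _+_ (+-identityʳ (X 0)) (trans
  (∑-cong (suc N) (λ a → cong (λ b → [ b ] * X (suc a)) (sym (≤ᵇ≡<ᵇ-suc a j))))
  (∑-≤ᵇ N j (λ a → X (suc a)) j≤N))

[+≡ᵇ] : ∀ a h j → [ a + h ≡ᵇ j ] ≡ [ a ≤ᵇ j ] * [ h ≡ᵇ j ∸ a ]
[+≡ᵇ] zero h j = sym (+-identityʳ _)
[+≡ᵇ] (suc a) h zero = refl
[+≡ᵇ] (suc a) h (suc j) = trans ([+≡ᵇ] a h j) (cong (λ b → [ b ] * [ h ≡ᵇ j ∸ a ]) (≤ᵇ≡<ᵇ-suc a j))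

sumBy-box≡levelSum : ∀ n N (S : Subset n) (f : Vec ℕ n → ℕ) j → j ≤ N →
  sumBy (λ v → [ supportedIn S v ] * ([ ht v ≡ᵇ j ] * f v)) (box n N) ≡ levelSum S f j
sumBy-box≡levelSum zero N [] f zero _ = rearrange (f [])
  where
  rearrange : ∀ x → 1 * (1 * x) + 0 ≡ x * 1
  rearrange = solve-∀
sumBy-box≡levelSum zero N [] f (suc j) _ = sym (*-zeroʳ (f []))
sumBy-box≡levelSum (suc n) N (false ∷ S) f j j≤N = begin
  sumBy (λ v → [ supportedIn (false ∷ S) v ] * ([ ht v ≡ᵇ j ] * f v)) (box (suc n) N)
    ≡⟨ sumBy-box-∷ n N _ ⟩
  sumBy (λ v → [ supportedIn S v ] * ([ ht v ≡ᵇ j ] * f (0 ∷ v))) (box n N) + ∑ N (λ _ → sumBy (λ _ → 0) (box n N))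
    ≡⟨ cong₂ _+_ (sumBy-box≡levelSum n N S (λ v → f (0 ∷ v)) j j≤N) (∑-zero N (λ _ _ → sumBy-zero (box n N))) ⟩
  levelSum S (λ v → f (0 ∷ v)) j + 0
    ≡⟨ +-identityʳ _ ⟩
  levelSum (false ∷ S) f j
    ∎
  where open ≡-Reasoning
sumBy-box≡levelSum (suc n) N (true ∷ S) f j j≤N = begin
  sumBy (λ v → [ supportedIn (true ∷ S) v ] * ([ ht v ≡ᵇ j ] * f v)) (box (suc n) N)
    ≡⟨ sumBy-box-∷ n N _ ⟩
  ∑ (suc N) (λ a → sumBy (λ v → [ supportedIn S v ] * ([ a + ht v ≡ᵇ j ] * f (a ∷ v))) (box n N))
    ≡⟨ ∑-cong (suc N) (λ a → sumBy-cong (box n N) (λ v →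
         trans (cong (λ x → [ supportedIn S v ] * (x * f (a ∷ v))) ([+≡ᵇ] a (ht v) j))
               (rearrange [ supportedIn S v ] [ a ≤ᵇ j ] [ ht v ≡ᵇ j ∸ a ] (f (a ∷ v))))) ⟩
  ∑ (suc N) (λ a → sumBy (λ v → [ a ≤ᵇ j ] * ([ supportedIn S v ] * ([ ht v ≡ᵇ j ∸ a ] * f (a ∷ v)))) (box n N))
    ≡⟨ ∑-cong (suc N) (λ a → trans (sumBy-*ˡ (box n N) [ a ≤ᵇ j ] _)
         (cong ([ a ≤ᵇ j ] *_) (sumBy-box≡levelSum n N S (λ v → f (a ∷ v)) (j ∸ a) (≤-trans (m∸n≤m j a) j≤N)))) ⟩
  ∑ (suc N) (λ a → [ a ≤ᵇ j ] * levelSum S (λ v → f (a ∷ v)) (j ∸ a))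
    ≡⟨ ∑-≤ᵇ N j (λ a → levelSum S (λ v → f (a ∷ v)) (j ∸ a)) j≤N ⟩
  levelSum (true ∷ S) f j
    ∎
  where
  open ≡-Reasoning
  rearrange : ∀ s b e x → s * ((b * e) * x) ≡ b * (s * (e * x))
  rearrange = solve-∀

-- Counting multichains

DownClosed : ∀ {n} → (Vec ℕ n → Bool) → Set
DownClosed P = ∀ e f → T (leqV e f) → T (P f) → T (P e)

sumBy-seqs-filter : ∀ {A : Set} m (p : A → Bool) (xs : List A) (φ : List A → ℕ) →
  sumBy φ (seqs m (filter (λ x → T? (p x)) xs)) ≡ sumBy (λ c → [ allB p c ] * φ c) (seqs m xs)
sumBy-seqs-filter zero p xs φ = cong (_+ 0) (sym (+-identityʳ (φ [])))
sumBy-seqs-filter (suc m) p xs φ = begin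
  sumBy φ (concatMap (λ a → map (a ∷_) (seqs m F)) F)
    ≡⟨ sumBy-concatMap F _ φ ⟩
  sumBy (λ a → sumBy φ (map (a ∷_) (seqs m F))) F
    ≡⟨ sumBy-cong F (λ a → trans (sumBy-map (seqs m F) (a ∷_) φ) (sumBy-seqs-filter m p xs (λ c → φ (a ∷ c)))) ⟩
  sumBy (λ a → sumBy (λ c → [ allB p c ] * φ (a ∷ c)) (seqs m xs)) F
    ≡⟨ sumBy-filter p _ xs ⟩
  sumBy (λ a → [ p a ] * sumBy (λ c → [ allB p c ] * φ (a ∷ c)) (seqs m xs)) xs
    ≡⟨ sumBy-cong xs (λ a → trans (sym (sumBy-*ˡ (seqs m xs) [ p a ] _))
         (trans (sumBy-cong (seqs m xs) (λ c → trans (sym (*-assoc [ p a ] [ allB p c ] _))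
                                                      (cong (_* φ (a ∷ c)) (sym ([∧] (p a) (allB p c))))))
                (sym (sumBy-map (seqs m xs) (a ∷_) (λ c → [ allB p c ] * φ c))))) ⟩
  sumBy (λ a → sumBy (λ c → [ allB p c ] * φ c) (map (a ∷_) (seqs m xs))) xs
    ≡⟨ sumBy-concatMap xs _ _ ⟨
  sumBy (λ c → [ allB p c ] * φ c) (concatMap (λ a → map (a ∷_) (seqs m xs)) xs)
    ∎
  where
  open ≡-Reasoning
  F = filter (λ x → T? (p x)) xs

chainWeight : ∀ {n} → (Vec ℕ n → ℕ) → Vec ℕ n → List (Vec ℕ n) → ℕ
chainWeight g e [] = g e
chainWeight g e (f ∷ es) = [ leqV e f ] * chainWeight g f es

chainWeight-downClosed : ∀ {n} (P : Vec ℕ n → Bool) → DownClosed P → ∀ j e c →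
  [ allB P (e ∷ c) ] * [ isMultichain (e ∷ c) ∧ (lastHt (e ∷ c) ≡ᵇ j) ]
    ≡ chainWeight (λ v → [ P v ] * [ ht v ≡ᵇ j ]) e c
chainWeight-downClosed P P↓ j e [] with P e
... | true = refl
... | false = refl
chainWeight-downClosed P P↓ j e (f ∷ es) =
  trans (step (P e) (P f) (allB P es) (leqV e f) (isMultichain (f ∷ es)) (lastHt (f ∷ es) ≡ᵇ j) (P↓ e f))
        (cong ([ leqV e f ] *_) (chainWeight-downClosed P P↓ j f es))
  where
  step : ∀ pe pf rest l m z → (T l → T pf → T pe) →
    [ pe ∧ (pf ∧ rest) ] * [ (l ∧ m) ∧ z ] ≡ [ l ] * ([ pf ∧ rest ] * [ m ∧ z ])
  step pe pf rest false m z _ = *-zeroʳ [ pe ∧ (pf ∧ rest) ]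
  step true false rest true m z _ = refl
  step false false rest true m z _ = refl
  step true true rest true m z _ = sym (+-identityʳ _)
  step false true rest true m z le with le _ _
  ... | ()

downSum : ∀ {n} → List (Vec ℕ n) → (Vec ℕ n → ℕ) → Vec ℕ n → ℕ
downSum Bs h u = sumBy (λ e → [ leqV e u ] * h e) Bs

downSum^ : ∀ {n} → List (Vec ℕ n) → ℕ → (Vec ℕ n → ℕ) → Vec ℕ n → ℕ
downSum^ Bs zero h = h
downSum^ Bs (suc m) h = downSum^ Bs m (downSum Bs h)

sumBy-chainWeight : ∀ {n} (Bs : List (Vec ℕ n)) g m h →
  sumBy (λ e → h e * sumBy (chainWeight g e) (seqs m Bs)) Bs ≡ sumBy (λ v → downSum^ Bs m h v * g v) Bs
sumBy-chainWeight Bs g zero h = sumBy-cong Bs (λ e → cong (h e *_) (+-identityʳ (g e)))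
sumBy-chainWeight Bs g (suc m) h = begin
  sumBy (λ e → h e * sumBy (chainWeight g e) (concatMap (λ f → map (f ∷_) (seqs m Bs)) Bs)) Bs
    ≡⟨ sumBy-cong Bs (λ e → cong (h e *_) (trans (sumBy-concatMap Bs _ (chainWeight g e))
         (sumBy-cong Bs (λ f → trans (sumBy-map (seqs m Bs) (f ∷_) (chainWeight g e))
                                     (sumBy-*ˡ (seqs m Bs) [ leqV e f ] (chainWeight g f)))))) ⟩
  sumBy (λ e → h e * sumBy (λ f → [ leqV e f ] * W f) Bs) Bs
    ≡⟨ sumBy-cong Bs (λ e → sym (sumBy-*ˡ Bs (h e) _)) ⟩
  sumBy (λ e → sumBy (λ f → h e * ([ leqV e f ] * W f)) Bs) Bs
    ≡⟨ sumBy-swap Bs Bs _ ⟩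
  sumBy (λ f → sumBy (λ e → h e * ([ leqV e f ] * W f)) Bs) Bs
    ≡⟨ sumBy-cong Bs (λ f → trans (sumBy-cong Bs (λ e → rearrange (h e) [ leqV e f ] (W f)))
                                   (sumBy-*ʳ Bs (W f) (λ e → [ leqV e f ] * h e))) ⟩
  sumBy (λ f → downSum Bs h f * W f) Bs
    ≡⟨ sumBy-chainWeight Bs g m (downSum Bs h) ⟩
  sumBy (λ v → downSum^ Bs (suc m) h v * g v) Bs
    ∎
  where
  open ≡-Reasoning
  W : _ → ℕ
  W f = sumBy (chainWeight g f) (seqs m Bs)
  rearrange : ∀ a b c → a * (b * c) ≡ b * a * c
  rearrange = solve-∀

multichainCount : ∀ {n} (P : Vec ℕ n → Bool) → DownClosed P → ∀ (Bs : List (Vec ℕ n)) m j →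
  length (filter (λ c → T? (isMultichain c ∧ (lastHt c ≡ᵇ j))) (seqs (suc m) (filter (λ x → T? (P x)) Bs)))
    ≡ sumBy (λ v → downSum^ Bs m (λ _ → 1) v * ([ P v ] * [ ht v ≡ᵇ j ])) Bs
multichainCount P P↓ Bs m j = begin
  length (filter (λ c → T? (Chain c)) (seqs (suc m) (filter (λ x → T? (P x)) Bs)))
    ≡⟨ length-filter Chain (seqs (suc m) (filter (λ x → T? (P x)) Bs)) ⟩
  sumBy (λ c → [ Chain c ]) (seqs (suc m) (filter (λ x → T? (P x)) Bs))
    ≡⟨ sumBy-seqs-filter (suc m) P Bs (λ c → [ Chain c ]) ⟩
  sumBy (λ c → [ allB P c ] * [ Chain c ]) (seqs (suc m) Bs)
    ≡⟨ sumBy-concatMap Bs (λ e → map (e ∷_) (seqs m Bs)) _ ⟩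
  sumBy (λ e → sumBy (λ c → [ allB P c ] * [ Chain c ]) (map (e ∷_) (seqs m Bs))) Bs
    ≡⟨ sumBy-cong Bs (λ e → trans (sumBy-map (seqs m Bs) (e ∷_) _)
         (trans (sumBy-cong (seqs m Bs) (chainWeight-downClosed P P↓ j e)) (sym (+-identityʳ _)))) ⟩
  sumBy (λ e → 1 * sumBy (chainWeight g e) (seqs m Bs)) Bs
    ≡⟨ sumBy-chainWeight Bs g m (λ _ → 1) ⟩
  sumBy (λ v → downSum^ Bs m (λ _ → 1) v * g v) Bs
    ∎
  where
  open ≡-Reasoning
  Chain : List _ → Bool
  Chain c = isMultichain c ∧ (lastHt c ≡ᵇ j)
  g : _ → ℕ
  g v = [ P v ] * [ ht v ≡ᵇ j ]

downSum^-cong : ∀ n N m (h h′ : Vec ℕ n → ℕ) → (∀ v → Vec.All (_≤ N) v → h v ≡ h′ v) →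
  ∀ v → Vec.All (_≤ N) v → downSum^ (box n N) m h v ≡ downSum^ (box n N) m h′ v
downSum^-cong n N zero h h′ eq v v≤N = eq v v≤N
downSum^-cong n N (suc m) h h′ eq v v≤N =
  downSum^-cong n N m (downSum (box n N) h) (downSum (box n N) h′)
    (λ u _ → sumBy-box-cong n N _ _ (λ e e≤N → cong ([ leqV e u ] *_) (eq e e≤N))) v v≤N

downSum-∏ : ∀ n N (w : ℕ → ℕ) (u : Vec ℕ n) → Vec.All (_≤ N) u →
  downSum (box n N) (∏ w) u ≡ ∏ (partialSums w) u
downSum-∏ zero N w [] _ = refl
downSum-∏ (suc n) N w (b ∷ u) (b≤N Vec.∷ u≤N) = begin
  sumBy (λ e → [ leqV e (b ∷ u) ] * ∏ w e) (box (suc n) N)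
    ≡⟨ sumBy-box-∷ n N _ ⟩
  ∑ (suc N) (λ a → sumBy (λ e → [ (a ≤ᵇ b) ∧ leqV e u ] * (w a * ∏ w e)) (box n N))
    ≡⟨ ∑-cong (suc N) (λ a → trans
         (sumBy-cong (box n N) (λ e → trans (cong (_* (w a * ∏ w e)) ([∧] (a ≤ᵇ b) (leqV e u)))
                                            (rearrange [ a ≤ᵇ b ] [ leqV e u ] (w a) (∏ w e))))
         (sumBy-*ˡ (box n N) ([ a ≤ᵇ b ] * w a) (λ e → [ leqV e u ] * ∏ w e))) ⟩
  ∑ (suc N) (λ a → [ a ≤ᵇ b ] * w a * downSum (box n N) (∏ w) u)
    ≡⟨ ∑-*ʳ (suc N) _ (λ a → [ a ≤ᵇ b ] * w a) ⟩
  ∑ (suc N) (λ a → [ a ≤ᵇ b ] * w a) * downSum (box n N) (∏ w) u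
    ≡⟨ cong₂ _*_ (∑-≤ᵇ N b w b≤N) (downSum-∏ n N w u u≤N) ⟩
  ∏ (partialSums w) (b ∷ u)
    ∎
  where
  open ≡-Reasoning
  rearrange : ∀ x y p q → x * y * (p * q) ≡ x * p * (y * q)
  rearrange = solve-∀

downSum^-∏-multichoose : ∀ n N m k (v : Vec ℕ n) → Vec.All (_≤ N) v →
  downSum^ (box n N) m (∏ (multichoose k)) v ≡ ∏ (multichoose (m + k)) v
downSum^-∏-multichoose n N zero k v v≤N = refl
downSum^-∏-multichoose n N (suc m) k v v≤N = begin
  downSum^ (box n N) m (downSum (box n N) (∏ (multichoose k))) v
    ≡⟨ downSum^-cong n N m _ _ (λ u u≤N → trans (downSum-∏ n N (multichoose k) u u≤N)
                                                (∏-cong (partialSums-multichoose k) u)) v v≤N ⟩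
  downSum^ (box n N) m (∏ (multichoose (suc k))) v
    ≡⟨ downSum^-∏-multichoose n N m (suc k) v v≤N ⟩
  ∏ (multichoose (m + suc k)) v
    ≡⟨ cong (λ x → ∏ (multichoose x) v) (+-suc m k) ⟩
  ∏ (multichoose (suc m + k)) v
    ∎
  where open ≡-Reasoning

downSum^-one : ∀ n N m (v : Vec ℕ n) → Vec.All (_≤ N) v →
  downSum^ (box n N) m (λ _ → 1) v ≡ ∏ (multichoose (suc m)) v
downSum^-one n N m v v≤N = begin
  downSum^ (box n N) m (λ _ → 1) v
    ≡⟨ downSum^-cong n N m _ _ (λ u _ → trans (sym (∏-one u)) (∏-cong (λ a → sym (multichoose-one a)) u)) v v≤N ⟩
  downSum^ (box n N) m (∏ (multichoose 1)) v
    ≡⟨ downSum^-∏-multichoose n N m 1 v v≤N ⟩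
  ∏ (multichoose (m + 1)) v
    ≡⟨ cong (λ x → ∏ (multichoose x) v) (+-comm m 1) ⟩
  ∏ (multichoose (suc m)) v
    ∎
  where open ≡-Reasoning

-- The poset P_t

supportedIn-downClosed : ∀ {n} (S : Subset n) → DownClosed (supportedIn S)
supportedIn-downClosed [] [] [] _ _ = _
supportedIn-downClosed (true ∷ S) (a ∷ e) (c ∷ f) a≤c∧e≤f f∈S =
  supportedIn-downClosed S e f (proj₂ (to T-∧ a≤c∧e≤f)) f∈S
supportedIn-downClosed (false ∷ S) (a ∷ e) (c ∷ f) a≤c∧e≤f c≡0∧f∈S
  with to T-∧ a≤c∧e≤f | to T-∧ c≡0∧f∈S
... | a≤c , e≤f | c≡0 , f∈S = from T-∧
  ( ≡⇒≡ᵇ a 0 (n≤0⇒n≡0 (subst (a ≤_) (≡ᵇ⇒≡ c 0 c≡0) (≤ᵇ⇒≤ a c a≤c)))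
  , supportedIn-downClosed S e f e≤f f∈S )

sumOver-mono : ∀ {n} (S : Subset n) (e f : Vec ℕ n) → T (leqV e f) → sumOver S e ≤ sumOver S f
sumOver-mono [] [] [] _ = z≤n
sumOver-mono (true ∷ S) (a ∷ e) (c ∷ f) a≤c∧e≤f with to T-∧ a≤c∧e≤f
... | a≤c , e≤f = +-mono-≤ (≤ᵇ⇒≤ a c a≤c) (sumOver-mono S e f e≤f)
sumOver-mono (false ∷ S) (a ∷ e) (c ∷ f) a≤c∧e≤f = sumOver-mono S e f (proj₂ (to T-∧ a≤c∧e≤f))

allB-mono : ∀ {A : Set} {p p′ : A → Bool} (xs : List A) → (∀ x → T (p x) → T (p′ x)) →
  T (allB p xs) → T (allB p′ xs)
allB-mono [] p⇒p′ _ = _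
allB-mono (x ∷ xs) p⇒p′ px∧pxs with to T-∧ px∧pxs
... | px , pxs = from T-∧ (p⇒p′ x px , allB-mono xs p⇒p′ pxs)

inP-downClosed : ∀ {n} (t : Arbor n) → DownClosed (inP t)
inP-downClosed t e f e≤f f∈P with to T-∧ f∈P
... | f∈S , f-bounded = from T-∧
  ( supportedIn-downClosed (𝒟 t) e f e≤f f∈S
  , allB-mono (vertices t) (λ u h → ≤⇒≤ᵇ (≤-trans (sumOver-mono (𝒟 u) e f e≤f) (≤ᵇ⇒≤ _ _ h))) f-bounded )

vertexBound : ∀ {n} → Vec ℕ n → Arbor n → Bool
vertexBound v u = sumOver (𝒟 u) v ≤ᵇ ∣ 𝒟 u ∣

-- For v ∈ P_t, weight M t v is the number of multichains e₁ ≤ ⋯ ≤ e_M = v in ℕⁿ,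
-- all of which lie in the down-closed set P_t.
weight : ∀ {n} → ℕ → Arbor n → Vec ℕ n → ℕ
weight M t v = ∏ (multichoose M) v * [ allB (vertexBound v) (vertices t) ]

Zcoef≡levelSum : ∀ {n} (t : Arbor n) m j → j ≤ n →
  Zcoef t (suc (suc m)) j ≡ levelSum (𝒟 t) (weight (suc m) t) j
Zcoef≡levelSum {n} t m j j≤n = begin
  Zcoef t (suc (suc m)) j
    ≡⟨ multichainCount (inP t) (inP-downClosed t) (box n n) m j ⟩
  sumBy (λ v → downSum^ (box n n) m (λ _ → 1) v * ([ inP t v ] * [ ht v ≡ᵇ j ])) (box n n)
    ≡⟨ sumBy-box-cong n n _ _ (λ v v≤n → trans (cong (_* ([ inP t v ] * [ ht v ≡ᵇ j ])) (downSum^-one n n m v v≤n))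
                                              (split-inP v)) ⟩
  sumBy (λ v → [ supportedIn (𝒟 t) v ] * ([ ht v ≡ᵇ j ] * weight (suc m) t v)) (box n n)
    ≡⟨ sumBy-box≡levelSum n n (𝒟 t) (weight (suc m) t) j j≤n ⟩
  levelSum (𝒟 t) (weight (suc m) t) j
    ∎
  where
  open ≡-Reasoning
  rearrange : ∀ w s c h → w * (s * c * h) ≡ s * (h * (w * c))
  rearrange = solve-∀
  split-inP : ∀ v → ∏ (multichoose (suc m)) v * ([ inP t v ] * [ ht v ≡ᵇ j ])
                    ≡ [ supportedIn (𝒟 t) v ] * ([ ht v ≡ᵇ j ] * weight (suc m) t v)
  split-inP v = trans
    (cong (λ x → ∏ (multichoose (suc m)) v * (x * [ ht v ≡ᵇ j ])) ([∧] (supportedIn (𝒟 t) v) _))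
    (rearrange (∏ (multichoose (suc m)) v) [ supportedIn (𝒟 t) v ] [ allB (vertexBound v) (vertices t) ] [ ht v ≡ᵇ j ])

_⊑_ : ∀ {n} → Subset n → Subset n → Set
A ⊑ V = A ∩ V ≡ A

⊑-∪ˡ : ∀ {n} (A X : Subset n) → A ⊑ (A ∪ X)
⊑-∪ˡ A X = ∩-abs-∪ A X

⊑-∪ʳ : ∀ {n} (A X : Subset n) → X ⊑ (A ∪ X)
⊑-∪ʳ A X = trans (cong (X ∩_) (∪-comm A X)) (∩-abs-∪ X A)

⊑-trans : ∀ {n} {A X Y : Subset n} → A ⊑ X → X ⊑ Y → A ⊑ Y
⊑-trans {A = A} {X} {Y} A⊑X X⊑Y =
  trans (cong (_∩ Y) (sym A⊑X)) (trans (∩-assoc A X Y) (trans (cong (A ∩_) X⊑Y) A⊑X))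

Disjoint-∪ˡ : ∀ {n} {A X Y : Subset n} → Disjoint A Y → Disjoint X Y → Disjoint (A ∪ X) Y
Disjoint-∪ˡ {A = A} {X} {Y} A#Y X#Y = trans (∩-distribʳ-∪ Y A X) (trans (cong₂ _∪_ A#Y X#Y) (∪-identityˡ ∅))

Disjoint-∪ʳ : ∀ {n} {A X Y : Subset n} → Disjoint A X → Disjoint A Y → Disjoint A (X ∪ Y)
Disjoint-∪ʳ {A = A} {X} {Y} A#X A#Y = trans (∩-distribˡ-∪ A X Y) (trans (cong₂ _∪_ A#X A#Y) (∪-identityˡ ∅))

Disjoint-⋃ʳ : ∀ {n} {A : Subset n} {ys} → All (Disjoint A) ys → Disjoint A (⋃ ys)
Disjoint-⋃ʳ {A = A} [] = ∩-zeroʳ A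
Disjoint-⋃ʳ (A#y ∷ A#ys) = Disjoint-∪ʳ A#y (Disjoint-⋃ʳ A#ys)

Disjoint-⋃ : ∀ {n} {xs ys : List (Subset n)} → All (λ x → All (Disjoint x) ys) xs → Disjoint (⋃ xs) (⋃ ys)
Disjoint-⋃ {ys = ys} [] = ∩-zeroˡ (⋃ ys)
Disjoint-⋃ (x#ys ∷ xs#ys) = Disjoint-∪ˡ (Disjoint-⋃ʳ x#ys) (Disjoint-⋃ xs#ys)

AllPairs-++⁻ : ∀ {A : Set} {R : A → A → Set} (xs : List A) {ys} → AllPairs R (xs ++ ys) →
  AllPairs R xs × AllPairs R ys × All (λ x → All (R x) ys) xs
AllPairs-++⁻ [] Rys = [] , Rys , []
AllPairs-++⁻ (x ∷ xs) (Rx ∷ Rxs) with AllPairs-++⁻ xs Rxs | All.++⁻ xs Rx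
... | Rxs′ , Rys , Rxsys | Rxxs , Rxys = (Rxxs ∷ Rxs′) , Rys , (Rxys ∷ Rxsys)

⋃-++ : ∀ {n} (xs ys : List (Subset n)) → ⋃ (xs ++ ys) ≡ ⋃ xs ∪ ⋃ ys
⋃-++ [] ys = sym (∪-identityˡ _)
⋃-++ (x ∷ xs) ys = trans (cong (x ∪_) (⋃-++ xs ys)) (sym (∪-assoc x (⋃ xs) (⋃ ys)))

allB-++ : ∀ {A : Set} (p : A → Bool) (xs ys : List A) → allB p (xs ++ ys) ≡ allB p xs ∧ allB p ys
allB-++ p [] ys = refl
allB-++ p (x ∷ xs) ys = trans (cong (p x ∧_) (allB-++ p xs ys)) (sym (∧-assoc (p x) _ _))

∣∪∣ : ∀ {n} (X Y : Subset n) → Disjoint X Y → ∣ X ∪ Y ∣ ≡ ∣ X ∣ + ∣ Y ∣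
∣∪∣ [] [] _ = refl
∣∪∣ (true ∷ X) (false ∷ Y) X#Y = cong suc (∣∪∣ X Y (∷-injectiveʳ X#Y))
∣∪∣ (false ∷ X) (true ∷ Y) X#Y = trans (cong suc (∣∪∣ X Y (∷-injectiveʳ X#Y))) (sym (+-suc _ _))
∣∪∣ (false ∷ X) (false ∷ Y) X#Y = ∣∪∣ X Y (∷-injectiveʳ X#Y)
∣∪∣ (true ∷ X) (true ∷ Y) ()

restrict-restrict : ∀ {n} (X Y : Subset n) (v : Vec ℕ n) → restrict X (restrict Y v) ≡ restrict (X ∩ Y) v
restrict-restrict [] [] [] = refl
restrict-restrict (true ∷ X) (true ∷ Y) (a ∷ v) = cong (a ∷_) (restrict-restrict X Y v)
restrict-restrict (true ∷ X) (false ∷ Y) (a ∷ v) = cong (0 ∷_) (restrict-restrict X Y v)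
restrict-restrict (false ∷ X) (true ∷ Y) (a ∷ v) = cong (0 ∷_) (restrict-restrict X Y v)
restrict-restrict (false ∷ X) (false ∷ Y) (a ∷ v) = cong (0 ∷_) (restrict-restrict X Y v)

restrict-⊑ : ∀ {n} {X V : Subset n} (v : Vec ℕ n) → X ⊑ V → restrict X (restrict V v) ≡ restrict X v
restrict-⊑ {X = X} {V} v X⊑V = trans (restrict-restrict X V v) (cong (λ S → restrict S v) X⊑V)

restrict-supported : ∀ {n} (S : Subset n) (v : Vec ℕ n) → T (supportedIn S v) → restrict S v ≡ v
restrict-supported [] [] _ = refl
restrict-supported (true ∷ S) (a ∷ v) v∈S = cong (a ∷_) (restrict-supported S v v∈S)
restrict-supported (false ∷ S) (a ∷ v) a≡0∧v∈S with to T-∧ a≡0∧v∈S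
... | a≡0 , v∈S = cong₂ _∷_ (sym (≡ᵇ⇒≡ a 0 a≡0)) (restrict-supported S v v∈S)

sumOver-restrict : ∀ {n} (X Y : Subset n) (v : Vec ℕ n) → sumOver X (restrict Y v) ≡ sumOver (X ∩ Y) v
sumOver-restrict [] [] [] = refl
sumOver-restrict (true ∷ X) (true ∷ Y) (a ∷ v) = cong (a +_) (sumOver-restrict X Y v)
sumOver-restrict (true ∷ X) (false ∷ Y) (a ∷ v) = sumOver-restrict X Y v
sumOver-restrict (false ∷ X) (true ∷ Y) (a ∷ v) = sumOver-restrict X Y v
sumOver-restrict (false ∷ X) (false ∷ Y) (a ∷ v) = sumOver-restrict X Y v

sumOver-supported : ∀ {n} (X : Subset n) (v : Vec ℕ n) → T (supportedIn X v) → sumOver X v ≡ ht v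
sumOver-supported [] [] _ = refl
sumOver-supported (true ∷ X) (a ∷ v) v∈X = cong (a +_) (sumOver-supported X v v∈X)
sumOver-supported (false ∷ X) (a ∷ v) a≡0∧v∈X with to T-∧ a≡0∧v∈X
... | a≡0 , v∈X = cong₂ _+_ (sym (≡ᵇ⇒≡ a 0 a≡0)) (sumOver-supported X v v∈X)

∏-restrict-∪ : ∀ {n} (w : ℕ → ℕ) → w 0 ≡ 1 → (X Y : Subset n) (v : Vec ℕ n) → Disjoint X Y →
  ∏ w (restrict (X ∪ Y) v) ≡ ∏ w (restrict X v) * ∏ w (restrict Y v)
∏-restrict-∪ w w0≡1 [] [] [] _ = refl
∏-restrict-∪ w w0≡1 (true ∷ X) (false ∷ Y) (a ∷ v) X#Y rewrite w0≡1 =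
  trans (cong (w a *_) (∏-restrict-∪ w w0≡1 X Y v (∷-injectiveʳ X#Y))) (rearrange (w a) (∏ w (restrict X v)) (∏ w (restrict Y v)))
  where
  rearrange : ∀ x p q → x * (p * q) ≡ x * p * (1 * q)
  rearrange = solve-∀
∏-restrict-∪ w w0≡1 (false ∷ X) (true ∷ Y) (a ∷ v) X#Y rewrite w0≡1 =
  trans (cong (w a *_) (∏-restrict-∪ w w0≡1 X Y v (∷-injectiveʳ X#Y))) (rearrange (w a) (∏ w (restrict X v)) (∏ w (restrict Y v)))
  where
  rearrange : ∀ x p q → x * (p * q) ≡ 1 * p * (x * q)
  rearrange = solve-∀
∏-restrict-∪ w w0≡1 (false ∷ X) (false ∷ Y) (a ∷ v) X#Y rewrite w0≡1 =
  trans (cong (1 *_) (∏-restrict-∪ w w0≡1 X Y v (∷-injectiveʳ X#Y))) (rearrange (∏ w (restrict X v)) (∏ w (restrict Y v)))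
  where
  rearrange : ∀ p q → 1 * (p * q) ≡ 1 * p * (1 * q)
  rearrange = solve-∀
∏-restrict-∪ w w0≡1 (true ∷ X) (true ∷ Y) (a ∷ v) ()

∏-restrict-∅ : ∀ {n} (w : ℕ → ℕ) → w 0 ≡ 1 → (v : Vec ℕ n) → ∏ w (restrict ∅ v) ≡ 1
∏-restrict-∅ w w0≡1 [] = refl
∏-restrict-∅ w w0≡1 (a ∷ v) = cong₂ _*_ w0≡1 (∏-restrict-∅ w w0≡1 v)

-- Weights of arbors and forests

𝒟F : ∀ {n} → List (Arbor n) → Subset n
𝒟F cs = ⋃ (labelsF cs)

𝒟F-∷ : ∀ {n} (c : Arbor n) cs → 𝒟F (c ∷ cs) ≡ 𝒟 c ∪ 𝒟F cs
𝒟F-∷ c cs = ⋃-++ (labels c) (labelsF cs)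

mutual
  allB-vertexBound-restrict : ∀ {n} (c : Arbor n) V v → 𝒟 c ⊑ V →
    allB (vertexBound (restrict V v)) (vertices c) ≡ allB (vertexBound v) (vertices c)
  allB-vertexBound-restrict (node L cs) V v 𝒟c⊑V = cong₂ _∧_
    (cong (_≤ᵇ ∣ 𝒟 (node L cs) ∣) (trans (sumOver-restrict (𝒟 (node L cs)) V v) (cong (λ S → sumOver S v) 𝒟c⊑V)))
    (allB-vertexBoundF-restrict cs V v (⊑-trans (⊑-∪ʳ L (𝒟F cs)) 𝒟c⊑V))

  allB-vertexBoundF-restrict : ∀ {n} (cs : List (Arbor n)) V v → 𝒟F cs ⊑ V →
    allB (vertexBound (restrict V v)) (verticesF cs) ≡ allB (vertexBound v) (verticesF cs)
  allB-vertexBoundF-restrict [] V v _ = refl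
  allB-vertexBoundF-restrict (c ∷ cs) V v 𝒟F⊑V = begin
    allB (vertexBound (restrict V v)) (vertices c ++ verticesF cs)
      ≡⟨ allB-++ _ (vertices c) (verticesF cs) ⟩
    allB (vertexBound (restrict V v)) (vertices c) ∧ allB (vertexBound (restrict V v)) (verticesF cs)
      ≡⟨ cong₂ _∧_ (allB-vertexBound-restrict c V v (⊑-trans (⊑-∪ˡ (𝒟 c) (𝒟F cs)) ∪⊑V))
                   (allB-vertexBoundF-restrict cs V v (⊑-trans (⊑-∪ʳ (𝒟 c) (𝒟F cs)) ∪⊑V)) ⟩
    allB (vertexBound v) (vertices c) ∧ allB (vertexBound v) (verticesF cs)
      ≡⟨ allB-++ _ (vertices c) (verticesF cs) ⟨
    allB (vertexBound v) (vertices c ++ verticesF cs)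
      ∎
    where
    open ≡-Reasoning
    ∪⊑V : (𝒟 c ∪ 𝒟F cs) ⊑ V
    ∪⊑V = subst (_⊑ V) (𝒟F-∷ c cs) 𝒟F⊑V

forestWeight : ∀ {n} → ℕ → List (Arbor n) → Vec ℕ n → ℕ
forestWeight M [] v = 1
forestWeight M (c ∷ cs) v = weight M c (restrict (𝒟 c) v) * forestWeight M cs v

forestWeight-restrict : ∀ {n} M (cs : List (Arbor n)) V v → 𝒟F cs ⊑ V →
  forestWeight M cs (restrict V v) ≡ forestWeight M cs v
forestWeight-restrict M [] V v _ = refl
forestWeight-restrict M (c ∷ cs) V v 𝒟F⊑V = cong₂ _*_
  (cong (weight M c) (restrict-⊑ v (⊑-trans (⊑-∪ˡ (𝒟 c) (𝒟F cs)) ∪⊑V)))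
  (forestWeight-restrict M cs V v (⊑-trans (⊑-∪ʳ (𝒟 c) (𝒟F cs)) ∪⊑V))
  where
  ∪⊑V : (𝒟 c ∪ 𝒟F cs) ⊑ V
  ∪⊑V = subst (_⊑ V) (𝒟F-∷ c cs) 𝒟F⊑V

forestWeight-∏ : ∀ {n} M (cs : List (Arbor n)) → AllPairs Disjoint (labelsF cs) → ∀ v →
  forestWeight M cs v ≡ ∏ (multichoose M) (restrict (𝒟F cs) v) * [ allB (vertexBound v) (verticesF cs) ]
forestWeight-∏ M [] _ v = sym (trans (*-identityʳ _) (∏-restrict-∅ (multichoose M) refl v))
forestWeight-∏ M (c ∷ cs) disjoint v with AllPairs-++⁻ (labels c) disjoint
... | _ , disjoint-cs , c#cs = begin
  ∏ w (restrict (𝒟 c) v) * [ allB (vertexBound (restrict (𝒟 c) v)) (vertices c) ] * forestWeight M cs v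
    ≡⟨ cong₂ _*_ (cong (λ b → ∏ w (restrict (𝒟 c) v) * [ b ]) (allB-vertexBound-restrict c (𝒟 c) v (∩-idem (𝒟 c))))
                 (forestWeight-∏ M cs disjoint-cs v) ⟩
  ∏ w (restrict (𝒟 c) v) * [ Bc ] * (∏ w (restrict (𝒟F cs) v) * [ Bcs ])
    ≡⟨ rearrange (∏ w (restrict (𝒟 c) v)) [ Bc ] (∏ w (restrict (𝒟F cs) v)) [ Bcs ] ⟩
  ∏ w (restrict (𝒟 c) v) * ∏ w (restrict (𝒟F cs) v) * ([ Bc ] * [ Bcs ])
    ≡⟨ cong₂ _*_ (∏-restrict-∪ w refl (𝒟 c) (𝒟F cs) v (Disjoint-⋃ c#cs)) ([∧] Bc Bcs) ⟨
  ∏ w (restrict (𝒟 c ∪ 𝒟F cs) v) * [ Bc ∧ Bcs ]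
    ≡⟨ cong₂ (λ S b → ∏ w (restrict S v) * [ b ]) (𝒟F-∷ c cs) (allB-++ (vertexBound v) (vertices c) (verticesF cs)) ⟨
  ∏ w (restrict (𝒟F (c ∷ cs)) v) * [ allB (vertexBound v) (verticesF (c ∷ cs)) ]
    ∎
  where
  open ≡-Reasoning
  w = multichoose M
  Bc = allB (vertexBound v) (vertices c)
  Bcs = allB (vertexBound v) (verticesF cs)
  rearrange : ∀ a b x y → a * b * (x * y) ≡ a * x * (b * y)
  rearrange = solve-∀

levelSum-forestWeight : ∀ {n} m (cs : List (Arbor n)) → AllPairs Disjoint (labelsF cs) → ∀ k → k ≤ n →
  levelSum (𝒟F cs) (forestWeight (suc m) cs) k ≡ Wcoef cs (suc (suc m)) k
levelSum-forestWeight {n} m [] _ k _ = levelSum-∅ n k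
levelSum-forestWeight {n} m (c ∷ cs) disjoint k k≤n with AllPairs-++⁻ (labels c) disjoint
... | _ , disjoint-cs , c#cs = begin
  levelSum (𝒟F (c ∷ cs)) (forestWeight M (c ∷ cs)) k
    ≡⟨ cong (λ S → levelSum S (forestWeight M (c ∷ cs)) k) (𝒟F-∷ c cs) ⟩
  levelSum (𝒟 c ∪ 𝒟F cs) (forestWeight M (c ∷ cs)) k
    ≡⟨ levelSum-cong (𝒟 c ∪ 𝒟F cs) _ _ k (λ v _ _ → cong (weight M c (restrict (𝒟 c) v) *_)
         (sym (forestWeight-restrict M cs (𝒟F cs) v (∩-idem (𝒟F cs))))) ⟩
  levelSum (𝒟 c ∪ 𝒟F cs) (λ v → weight M c (restrict (𝒟 c) v) * forestWeight M cs (restrict (𝒟F cs) v)) k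
    ≡⟨ levelSum-∪ (𝒟 c) (𝒟F cs) (weight M c) (forestWeight M cs) (Disjoint-⋃ c#cs) k ⟩
  conv (levelSum (𝒟 c) (weight M c)) (levelSum (𝒟F cs) (forestWeight M cs)) k
    ≡⟨ conv-congˡ (levelSum (𝒟F cs) (forestWeight M cs)) k (λ i i≤k → sym (Zcoef≡levelSum c m i (≤-trans i≤k k≤n))) ⟩
  conv (Zcoef c q) (levelSum (𝒟F cs) (forestWeight M cs)) k
    ≡⟨ conv-congʳ (Zcoef c q) k (λ i i≤k → levelSum-forestWeight m cs disjoint-cs i (≤-trans i≤k k≤n)) ⟩
  conv (Zcoef c q) (Wcoef cs q) k
    ≡⟨ ⊛≗conv (Zcoef c q) (Wcoef cs q) k ⟨
  Wcoef (c ∷ cs) q k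
    ∎
  where
  open ≡-Reasoning
  M = suc m
  q = suc M

weight-node : ∀ {n} M (R : Subset n) cs → AllPairs Disjoint (labels (node R cs)) → ∀ v →
  T (supportedIn (R ∪ 𝒟F cs) v) → ht v ≤ ∣ R ∪ 𝒟F cs ∣ →
  weight M (node R cs) v ≡ ∏ (multichoose M) (restrict R v) * forestWeight M cs (restrict (𝒟F cs) v)
weight-node M R cs (R#cs ∷ disjoint-cs) v v∈S ht≤∣S∣ = begin
  ∏ w v * [ (sumOver S v ≤ᵇ ∣ S ∣) ∧ A ]
    ≡⟨ cong (λ b → ∏ w v * [ b ∧ A ]) (to T-≡ root-bound) ⟩
  ∏ w v * [ A ]
    ≡⟨ cong (λ x → ∏ w x * [ A ]) (restrict-supported S v v∈S) ⟨
  ∏ w (restrict S v) * [ A ]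
    ≡⟨ cong (_* [ A ]) (∏-restrict-∪ w refl R (𝒟F cs) v (Disjoint-⋃ʳ R#cs)) ⟩
  ∏ w (restrict R v) * ∏ w (restrict (𝒟F cs) v) * [ A ]
    ≡⟨ *-assoc (∏ w (restrict R v)) _ _ ⟩
  ∏ w (restrict R v) * (∏ w (restrict (𝒟F cs) v) * [ A ])
    ≡⟨ cong (∏ w (restrict R v) *_) (forestWeight-∏ M cs disjoint-cs v) ⟨
  ∏ w (restrict R v) * forestWeight M cs v
    ≡⟨ cong (∏ w (restrict R v) *_) (forestWeight-restrict M cs (𝒟F cs) v (∩-idem (𝒟F cs))) ⟨
  ∏ w (restrict R v) * forestWeight M cs (restrict (𝒟F cs) v)
    ∎
  where
  open ≡-Reasoning
  w = multichoose M
  S = R ∪ 𝒟F cs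
  A = allB (vertexBound v) (verticesF cs)
  root-bound : T (sumOver S v ≤ᵇ ∣ S ∣)
  root-bound = ≤⇒≤ᵇ (subst (_≤ ∣ S ∣) (sym (sumOver-supported S v v∈S)) ht≤∣S∣)

Zcoef-node : ∀ {n} (R : Subset n) cs → AllPairs Disjoint (labels (node R cs)) → ∀ m j → j ≤ ∣ R ∪ 𝒟F cs ∣ →
  Zcoef (node R cs) (suc (suc m)) j ≡ conv (multichoose (∣ R ∣ * suc m)) (Wcoef cs (suc (suc m))) j
Zcoef-node R cs disjoint@(R#cs ∷ disjoint-cs) m j j≤∣S∣ = begin
  Zcoef (node R cs) (suc M) j
    ≡⟨ Zcoef≡levelSum (node R cs) m j j≤n ⟩
  levelSum S (weight M (node R cs)) j
    ≡⟨ levelSum-cong S _ _ j (λ v v∈S ht≡j → weight-node M R cs disjoint v v∈S (subst (_≤ ∣ S ∣) (sym ht≡j) j≤∣S∣)) ⟩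
  levelSum S (λ v → ∏ (multichoose M) (restrict R v) * forestWeight M cs (restrict (𝒟F cs) v)) j
    ≡⟨ levelSum-∪ R (𝒟F cs) (∏ (multichoose M)) (forestWeight M cs) (Disjoint-⋃ʳ R#cs) j ⟩
  conv (levelSum R (∏ (multichoose M))) (levelSum (𝒟F cs) (forestWeight M cs)) j
    ≡⟨ conv-congˡ (levelSum (𝒟F cs) (forestWeight M cs)) j (λ i _ → levelSum-∏-multichoose R M i) ⟩
  conv (multichoose (∣ R ∣ * M)) (levelSum (𝒟F cs) (forestWeight M cs)) j
    ≡⟨ conv-congʳ (multichoose (∣ R ∣ * M)) j (λ i i≤j → levelSum-forestWeight m cs disjoint-cs i (≤-trans i≤j j≤n)) ⟩
  conv (multichoose (∣ R ∣ * M)) (Wcoef cs (suc M)) j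
    ∎
  where
  open ≡-Reasoning
  M = suc m
  S = R ∪ 𝒟F cs
  j≤n = ≤-trans j≤∣S∣ (∣p∣≤n S)

≤ᵇ≡false : ∀ {x y} → y < x → (x ≤ᵇ y) ≡ false
≤ᵇ≡false {x} {y} y<x with x ≤ᵇ y in eq
... | false = refl
... | true = ⊥-elim (<⇒≱ y<x (≤ᵇ⇒≤ x y (subst T (sym eq) _)))

Zcoef-vanish : ∀ {n} (t : Arbor n) m i → ∣ 𝒟 t ∣ < i → i ≤ n → Zcoef t (suc (suc m)) i ≡ 0
Zcoef-vanish (node L cs) m i ∣S∣<i i≤n =
  trans (Zcoef≡levelSum (node L cs) m i i≤n) (levelSum-vanish S (weight (suc m) (node L cs)) i root-violated)
  where
  S = 𝒟 (node L cs)
  root-violated : ∀ v → T (supportedIn S v) → ht v ≡ i → weight (suc m) (node L cs) v ≡ 0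
  root-violated v v∈S ht≡i = trans
    (cong (λ b → ∏ (multichoose (suc m)) v * [ b ∧ allB (vertexBound v) (verticesF cs) ])
          (≤ᵇ≡false (subst (∣ S ∣ <_) (sym (trans (sumOver-supported S v v∈S) ht≡i)) ∣S∣<i)))
    (*-zeroʳ (∏ (multichoose (suc m)) v))

conv-vanish : ∀ {f g : ℕ → ℕ} a b N → (∀ i → a < i → i ≤ N → f i ≡ 0) → (∀ i → b < i → i ≤ N → g i ≡ 0) →
  ∀ k → a + b < k → k ≤ N → conv f g k ≡ 0
conv-vanish {f} {g} a b N f-vanish g-vanish k a+b<k k≤N = ∑-zero (suc k) term
  where
  term : ∀ i → i < suc k → f i * g (k ∸ i) ≡ 0
  term i i≤k with a <? i
  ... | yes a<i = cong (_* g (k ∸ i)) (f-vanish i a<i (≤-trans (≤-pred i≤k) k≤N))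
  ... | no a≮i = trans (cong (f i *_) (g-vanish (k ∸ i) b<k∸i (≤-trans (m∸n≤m k i) k≤N))) (*-zeroʳ (f i))
    where
    b<k∸i : b < k ∸ i
    b<k∸i = m+n≤o⇒m≤o∸n (suc b) (≤-trans (s≤s (≤-trans (+-monoʳ-≤ b (≮⇒≥ a≮i)) (≤-reflexive (+-comm b a)))) a+b<k)

Wcoef-vanish : ∀ {n} m (cs : List (Arbor n)) → AllPairs Disjoint (labelsF cs) → ∀ k → ∣ 𝒟F cs ∣ < k → k ≤ n →
  Wcoef cs (suc (suc m)) k ≡ 0
Wcoef-vanish m [] _ (suc k) _ _ = refl
Wcoef-vanish {n} m (c ∷ cs) disjoint k ∣𝒟F∣<k k≤n with AllPairs-++⁻ (labels c) disjoint
... | _ , disjoint-cs , c#cs = trans (⊛≗conv (Zcoef c (suc (suc m))) (Wcoef cs (suc (suc m))) k)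
  (conv-vanish ∣ 𝒟 c ∣ ∣ 𝒟F cs ∣ n (Zcoef-vanish c m) (Wcoef-vanish m cs disjoint-cs) k
    (subst (_< k) (trans (cong ∣_∣ (𝒟F-∷ c cs)) (∣∪∣ (𝒟 c) (𝒟F cs) (Disjoint-⋃ c#cs))) ∣𝒟F∣<k) k≤n)

conv≡sumFromTo : ∀ {f g : ℕ → ℕ} u j → (∀ k → u < k → k ≤ j → g k ≡ 0) →
  conv f g j ≡ sumFromTo (j ∸ u) j (λ ℓ → f ℓ * g (j ∸ ℓ))
conv≡sumFromTo {f} {g} u j g-vanish = begin
  ∑ (suc j) F                              ≡⟨ cong (λ k → ∑ k F) (m+[n∸m]≡n a≤1+j) ⟨
  ∑ (a + (suc j ∸ a)) F                    ≡⟨ ∑-split a (suc j ∸ a) F ⟩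
  ∑ a F + ∑ (suc j ∸ a) (λ i → F (a + i))  ≡⟨ cong (_+ ∑ (suc j ∸ a) (λ i → F (a + i))) (∑-zero a below) ⟩
  ∑ (suc j ∸ a) (λ i → F (a + i))          ≡⟨ sumFromTo≡∑ a j F ⟨
  sumFromTo a j F                          ∎
  where
  open ≡-Reasoning
  a = j ∸ u
  F : ℕ → ℕ
  F ℓ = f ℓ * g (j ∸ ℓ)
  a≤1+j : a ≤ suc j
  a≤1+j = ≤-trans (m∸n≤m j u) (n≤1+n j)
  u<j∸ℓ : ∀ {ℓ} → ℓ < j ∸ u → u < j ∸ ℓ
  u<j∸ℓ {ℓ} ℓ<j∸u with ≤-total u j
  ... | inj₁ u≤j = m+n≤o⇒m≤o∸n (suc u) (subst (_≤ j) (cong suc (+-comm ℓ u)) (m≤o∸n⇒m+n≤o (suc ℓ) u≤j ℓ<j∸u))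
  ... | inj₂ j≤u = ⊥-elim (n≮0 (subst (ℓ <_) (m≤n⇒m∸n≡0 j≤u) ℓ<j∸u))
  below : ∀ ℓ → ℓ < a → F ℓ ≡ 0
  below ℓ ℓ<a = trans (cong (f ℓ *_) (g-vanish (j ∸ ℓ) (u<j∸ℓ ℓ<a) (m∸n≤m j ℓ))) (*-zeroʳ (f ℓ))

proposition2p7 : (n : ℕ) → 2 ≤ n → (t : Arbor n) → IsArborOn t ⊤ →
    (q : ℕ) → 2 ≤ q → (j : ℕ) → j ≤ n →
      Zcoef t q j
        ≡ sumFromTo (j + ∣ rootLabel t ∣ ∸ n) j
            (λ ℓ → ((∣ rootLabel t ∣ * (q ∸ 1) + ℓ ∸ 1) C ℓ) * Wcoef (children t) q (j ∸ ℓ))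
proposition2p7 n _ t _ (suc zero) (s≤s ()) j _
proposition2p7 n _ (node R cs) (_ , disjoint@(R#cs ∷ disjoint-cs) , 𝒟≡⊤) (suc (suc m)) _ j j≤n = begin
  Zcoef (node R cs) q j
    ≡⟨ Zcoef-node R cs disjoint m j (subst (j ≤_) (sym ∣S∣≡n) j≤n) ⟩
  conv (multichoose (∣ R ∣ * suc m)) (Wcoef cs q) j
    ≡⟨ conv≡sumFromTo {f = multichoose (∣ R ∣ * suc m)} ∣ 𝒟F cs ∣ j (λ k u<k k≤j → Wcoef-vanish m cs disjoint-cs k u<k (≤-trans k≤j j≤n)) ⟩
  sumFromTo (j ∸ ∣ 𝒟F cs ∣) j F
    ≡⟨ cong (λ a → sumFromTo a j F) lower-limit ⟨
  sumFromTo (j + ∣ R ∣ ∸ n) j F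
    ∎
  where
  open ≡-Reasoning
  q = suc (suc m)
  F : ℕ → ℕ
  F ℓ = multichoose (∣ R ∣ * suc m) ℓ * Wcoef cs q (j ∸ ℓ)
  ∣S∣≡n : ∣ R ∪ 𝒟F cs ∣ ≡ n
  ∣S∣≡n = trans (cong ∣_∣ 𝒟≡⊤) (∣⊤∣≡n n)
  r = ∣ R ∣
  u = ∣ 𝒟F cs ∣
  lower-limit : j + r ∸ n ≡ j ∸ u
  lower-limit = begin
    j + r ∸ n        ≡⟨ cong (j + r ∸_) (trans (sym ∣S∣≡n) (∣∪∣ R (𝒟F cs) (Disjoint-⋃ʳ R#cs))) ⟩
    j + r ∸ (r + u)  ≡⟨ cong (_∸ (r + u)) (+-comm j r) ⟩
    r + j ∸ (r + u)  ≡⟨ [m+n]∸[m+o]≡n∸o r j u ⟩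
    j ∸ u            ∎
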